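{- For positive integers $x,y$ and nonnegative integers $r,s$, define $A(r,s|x,y)=\frac{1}{(x+y-1)!}A_{(0^r,1^{y-1},r+s+1,1^{x-1},0^s)}(1)$. Then for all positive integers $x,y,r,s$, $$A(r,s|x,y)=(s+x)A(r-1,s|x,y)+(r+y)A(r,s-1|x,y).$$
   Context: A configuration of size $n$ is a tuple $c=(c_1,\dots,c_n)$ of nonnegative integers with $\sum_i c_i=n$, viewed as $c_i$ balls at site $i\in\mathbb{Z}$. Here $0^k$ (resp. $1^k$) denotes $k$ zeros (resp. ones) and juxtaposition denotes concatenation. For real $q>0$, random dynamic: balls are dropped onto $\mathbb{Z}$ one at a time from their sites; a ball landing on an occupied site moves one site left with probability $q/(1+q)$ and right with probability $1/(1+q)$, repeating until it reaches an unoccupied site, where it settles; the law of the final occupied set does not depend on the dropping order. $\mathbb{P}_c(q)$ is the probability that the final occupied set is $[1;n]$. With $[i]=1+q+\dots+q^{i-1}$, $[n]!=[1]\cdots[n]$, $A_c(q)=[n]!\,\mathbb{P}_c(q)$ is a polynomial in $q$; $A_c(1)$ is its value at $q=1$. -}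

module Defs where

open import Data.Bool using (Bool; true; false; if_then_else_; _∧_)
open import Data.Nat as ℕ using (ℕ; zero; suc; _!; _∸_)
open import Data.Nat.Properties using (_!≢0)
open import Data.Integer as ℤ using (ℤ; +_)
open import Data.Rational as ℚ using (ℚ; 0ℚ; 1ℚ)
open import Data.List using (List; []; _∷_; length; replicate; concat; map; upTo; foldl; foldr; _++_; zip)
open import Data.Bool.ListAction using (any; all)
open import Data.Product using (_×_; _,_)
open import Relation.Nullary.Decidable using (⌊_⌋)

-- A configuration of size n: a list (c₁,…,cₙ) of natural numbers summing to n;
-- entry cᵢ (1-based) is the number of balls at site i ∈ ℤ.
Config : Set
Config = List ℕ

Sites : Set
Sites = List ℤ

_∈ᵇ_ : ℤ → Sites → Bool
z ∈ᵇ S = any (λ w → ⌊ z ℤ.≟ w ⌋) S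

Dist : Set → Set
Dist A = List (A × ℚ)

bind : {A B : Set} → Dist A → (A → Dist B) → Dist B
bind [] f = []
bind ((a , p) ∷ xs) f = map (λ { (b , q) → (b , p ℚ.* q) }) (f a) ++ bind xs f

runLeft : ℕ → Sites → ℤ → ℕ
runLeft zero S z = zero
runLeft (suc f) S z = if (z ℤ.- ℤ.1ℤ) ∈ᵇ S then suc (runLeft f S (z ℤ.- ℤ.1ℤ)) else zero

runRight : ℕ → Sites → ℤ → ℕ
runRight zero S z = zero
runRight (suc f) S z = if (z ℤ.+ ℤ.1ℤ) ∈ᵇ S then suc (runRight f S (z ℤ.+ ℤ.1ℤ)) else zero

-- Dropping one ball at site z onto occupied set S, with q = 1.
-- If z is free, the ball settles at z.  Otherwise it performs a symmetric
-- simple random walk (left/right with probability 1/2 each) on the maximal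
-- occupied block [z-l ; z+r] containing z until it first reaches a free
-- site, which is z-l-1 or z+r+1.  By the (symmetric) gambler's-ruin
-- formula it exits to the right with probability (l+1)/(l+r+2) and to the
-- left with probability (r+1)/(l+r+2).
drop1 : ℤ → Sites → Dist Sites
drop1 z S with z ∈ᵇ S
... | false = (z ∷ S , 1ℚ) ∷ []
... | true =
  let l = runLeft (length S) S z
      r = runRight (length S) S z
      L = suc l
      R = suc r
  in ((z ℤ.- + L) ∷ S , (+ R) ℚ./ (L ℕ.+ R))
   ∷ ((z ℤ.+ + R) ∷ S , (+ L) ℚ./ (L ℕ.+ R))
   ∷ []

-- List of the sites from which balls are dropped: site i repeated cᵢ times.
-- (the law of the final set does not depend on the order; we drop left to right)
ballSites : Config → List ℤ
ballSites c = concat (map (λ { (i , k) → replicate k (+ suc i) }) (zip (upTo (length c)) c))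

finalLaw : Config → Dist Sites
finalLaw c = foldl (λ d z → bind d (drop1 z)) ((([] , 1ℚ)) ∷ []) (ballSites c)

isInterval : ℕ → Sites → Bool
isInterval n S =
  all (λ k → (+ suc k) ∈ᵇ S) (upTo n)
  ∧ all (λ z → ⌊ ℤ.1ℤ ℤ.≤? z ⌋ ∧ ⌊ z ℤ.≤? + n ⌋) S

Prob : Config → ℚ
Prob c = sum' (map (λ { (S , p) → if isInterval (length c) S then p else 0ℚ }) (finalLaw c))
  where
  sum' : List ℚ → ℚ
  sum' = foldr ℚ._+_ 0ℚ

A₁ : Config → ℚ
A₁ c = (+ (length c !) ℚ./ 1) ℚ.* Prob c

conf : ℕ → ℕ → ℕ → ℕ → Config
conf r s x y = replicate r 0 ++ replicate (y ∸ 1) 1 ++ (r ℕ.+ s ℕ.+ 1) ∷ replicate (x ∸ 1) 1 ++ replicate s 0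

-- A(r,s|x,y) = A_{conf}(1) / (x+y-1)!   (intended for x, y ≥ 1)
A : ℕ → ℕ → ℕ → ℕ → ℚ
A r s x y = A₁ (conf r s x y) ℚ.* ((+ 1) ℚ./ ((x ℕ.+ y ∸ 1) !)) {{(x ℕ.+ y ∸ 1) !≢0}}

-- Drop the balls from left to right. The y − 1 ones and the first ball of the pile settle
-- at once into the block [r + 1, r + y]; from then on the occupied set is a block
-- [P − l, P + m] around the pile site P = r + y, and a ball landing in it leaves it to the
-- left or to the right with the gambler's-ruin probabilities, so each drop acts linearly on
-- functions of (l, m). Dropping at P commutes with dropping at any site of the block or next
-- to it (an identity between these probabilities), so the x − 1 ones may be dropped before
-- the pile, where they settle too. Hence ℙ is the probability that r + s balls dropped at P
-- take the block from (l, m) = (y − 1, x − 1) to (r + y − 1, s + x − 1). Splitting off the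
-- last of them gives n ℙ(r, s) = (s + x) ℙ(r − 1, s) + (r + y) ℙ(r, s − 1) for the size
-- n = r + s + x + y − 1, and multiplying by (n − 1)! / (x + y − 1)! gives the claim.

module Submission where

open import Defs
import Data.Nat
open import Data.Nat using (ℕ; _≤_; _∸_)
open import Data.Integer using (+_)
open import Data.Rational using (_+_; _*_; _/_)
open import Relation.Binary.PropositionalEquality using (_≡_)

open import Data.Nat as ℕ using (zero; suc; _!)
import Data.Nat.Properties as ℕP
open import Data.Integer as ℤ using (ℤ; 1ℤ)
import Data.Integer.Properties as ℤP
open import Algebra.Properties.AbelianGroup ℤP.+-0-abelianGroup using () renaming (∙-cancelˡ to ℤ-+-cancelˡ)
open import Data.Integer.Tactic.RingSolver as ℤ-Solver using ()
open import Data.Nat.Tactic.RingSolver as ℕ-Solver using ()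
open import Data.Rational as ℚ using (ℚ; 0ℚ; 1ℚ; -_; toℚᵘ)
import Data.Rational.Properties as ℚP
open import Data.Rational.Solver using (module +-*-Solver)
open import Data.Rational.Unnormalised using (mkℚᵘ; *≡*; _≃_)
import Data.Rational.Unnormalised.Properties as ℚᵘP
open import Data.Bool as Bool using (true; false; if_then_else_; _∧_)
open import Data.Bool.Properties using (∧-zeroʳ; T-≡; T-∧; ¬-not)
open import Data.Sum using (_⊎_; inj₁; inj₂)
open import Data.Empty using (⊥-elim)
open import Data.List using (List; []; _∷_; _++_; map; foldl; foldr; length; upTo; replicate; concat; zip; applyUpTo)
import Data.List.Properties as LP
open import Data.List.Relation.Unary.All as All using ()
open import Data.List.Relation.Unary.All.Properties using (all⁺; all⁻; applyUpTo⁺₁; applyUpTo⁻)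
open import Data.List.Membership.Propositional using (_∈_; _∉_)
open import Data.List.Relation.Unary.Any as Any using (here; there)
open import Data.List.Relation.Unary.Any.Properties using (any⁺; any⁻)
open import Data.Product using (_×_; _,_; proj₁; ∃-syntax)
open import Function using (id; _∘_; Equivalence; _⇔_; mk⇔)
open import Relation.Nullary using (¬_; yes; no; does)
open import Relation.Nullary.Decidable using (⌊_⌋; dec-true; dec-false; toWitness; fromWitness)
open import Relation.Binary.PropositionalEquality
  using (refl; sym; trans; cong; cong₂; subst; subst₂; module ≡-Reasoning)
open ≡-Reasoning
open +-*-Solver using (solve; _:+_; _:*_; _:-_; :-_; con; _:=_)

-- Unary, so that fromℕ (suc n) unfolds to 1ℚ + fromℕ n for the ring solver.
fromℕ : ℕ → ℚ
fromℕ zero    = 0ℚ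
fromℕ (suc n) = 1ℚ + fromℕ n

1/[1+_] : ℕ → ℚ
1/[1+ d ] = + 1 / suc d

fromℕ-+ : ∀ m n → fromℕ (m ℕ.+ n) ≡ fromℕ m + fromℕ n
fromℕ-+ zero    n = sym (ℚP.+-identityˡ (fromℕ n))
fromℕ-+ (suc m) n = trans (cong (ℚ._+_ 1ℚ) (fromℕ-+ m n)) (sym (ℚP.+-assoc 1ℚ (fromℕ m) (fromℕ n)))

fromℕ-* : ∀ m n → fromℕ (m ℕ.* n) ≡ fromℕ m * fromℕ n
fromℕ-* zero    n = sym (ℚP.*-zeroˡ (fromℕ n))
fromℕ-* (suc m) n = begin
  fromℕ (n ℕ.+ m ℕ.* n)         ≡⟨ fromℕ-+ n (m ℕ.* n) ⟩
  fromℕ n + fromℕ (m ℕ.* n)     ≡⟨ cong (ℚ._+_ (fromℕ n)) (fromℕ-* m n) ⟩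
  fromℕ n + fromℕ m * fromℕ n   ≡⟨ solve 2 (λ m n → n :+ m :* n := (con 1ℚ :+ m) :* n) refl (fromℕ m) (fromℕ n) ⟩
  (1ℚ + fromℕ m) * fromℕ n      ∎

private
  toℚᵘ-/ : ∀ z d → toℚᵘ (z / suc d) ≃ mkℚᵘ z d
  toℚᵘ-/ z d = ℚP.toℚᵘ-fromℚᵘ (mkℚᵘ z d)

  /1-suc : ∀ n → + suc n / 1 ≡ 1ℚ + + n / 1
  /1-suc n = ℚP.toℚᵘ-injective (ℚᵘP.≃-trans (toℚᵘ-/ (+ suc n) 0) (ℚᵘP.≃-trans (*≡* (cross-multiplied (+ n)))
    (ℚᵘP.≃-sym (ℚᵘP.≃-trans (ℚP.toℚᵘ-homo-+ 1ℚ (+ n / 1)) (ℚᵘP.+-congʳ (mkℚᵘ (+ 1) 0) (toℚᵘ-/ (+ n) 0))))))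
    where
    cross-multiplied : ∀ (x : ℤ) → (+ 1 ℤ.+ x) ℤ.* + 1 ≡ (+ 1 ℤ.* + 1 ℤ.+ x ℤ.* + 1) ℤ.* + 1
    cross-multiplied = ℤ-Solver.solve-∀

  /-suc : ∀ a d → + a / suc d ≡ + a / 1 * 1/[1+ d ]
  /-suc a d = ℚP.toℚᵘ-injective (ℚᵘP.≃-trans (toℚᵘ-/ (+ a) d) (ℚᵘP.≃-trans (*≡* cross)
    (ℚᵘP.≃-sym (ℚᵘP.≃-trans (ℚP.toℚᵘ-homo-* (+ a / 1) 1/[1+ d ]) (ℚᵘP.*-cong (toℚᵘ-/ (+ a) 0) (toℚᵘ-/ (+ 1) d))))))
    where
    cross-multiplied : ∀ (x y : ℤ) → x ℤ.* y ≡ (x ℤ.* + 1) ℤ.* y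
    cross-multiplied = ℤ-Solver.solve-∀
    cross : + a ℤ.* + suc (d ℕ.+ 0) ≡ (+ a ℤ.* + 1) ℤ.* + suc d
    cross rewrite ℕP.+-identityʳ d = cross-multiplied (+ a) (+ suc d)

  /1-*-1/[1+] : ∀ d → + suc d / 1 * 1/[1+ d ] ≡ 1ℚ
  /1-*-1/[1+] d = ℚP.toℚᵘ-injective (ℚᵘP.≃-trans (ℚP.toℚᵘ-homo-* (+ suc d / 1) 1/[1+ d ])
    (ℚᵘP.≃-trans (ℚᵘP.*-cong (toℚᵘ-/ (+ suc d) 0) (toℚᵘ-/ (+ 1) d)) (*≡* cross)))
    where
    cross-multiplied : ∀ (x : ℤ) → (x ℤ.* + 1) ℤ.* + 1 ≡ + 1 ℤ.* x
    cross-multiplied = ℤ-Solver.solve-∀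
    cross : (+ suc d ℤ.* + 1) ℤ.* + 1 ≡ + 1 ℤ.* + suc (d ℕ.+ 0)
    cross rewrite ℕP.+-identityʳ d = cross-multiplied (+ suc d)

/1≡fromℕ : ∀ n → + n / 1 ≡ fromℕ n
/1≡fromℕ zero    = refl
/1≡fromℕ (suc n) = trans (/1-suc n) (cong (ℚ._+_ 1ℚ) (/1≡fromℕ n))

/≡fromℕ-*-1/[1+] : ∀ a d → + a / suc d ≡ fromℕ a * 1/[1+ d ]
/≡fromℕ-*-1/[1+] a d = trans (/-suc a d) (cong (_* 1/[1+ d ]) (/1≡fromℕ a))

fromℕ-*-1/[1+] : ∀ d → fromℕ (suc d) * 1/[1+ d ] ≡ 1ℚ
fromℕ-*-1/[1+] d = trans (cong (_* 1/[1+ d ]) (sym (/1≡fromℕ (suc d)))) (/1-*-1/[1+] d)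

/1-* : ∀ m n → + (m ℕ.* n) / 1 ≡ + m / 1 * (+ n / 1)
/1-* m n = trans (/1≡fromℕ (m ℕ.* n)) (trans (fromℕ-* m n) (sym (cong₂ _*_ (/1≡fromℕ m) (/1≡fromℕ n))))

/1-*-/ : ∀ a {d d′} → d ≡ d′ → + suc d / 1 * (+ a / suc d′) ≡ + a / 1
/1-*-/ a {d} refl = begin
  + suc d / 1 * (+ a / suc d)          ≡⟨ cong₂ _*_ (/1≡fromℕ (suc d)) (/≡fromℕ-*-1/[1+] a d) ⟩
  fromℕ (suc d) * (fromℕ a * 1/[1+ d ])
    ≡⟨ solve 3 (λ n a u → n :* (a :* u) := a :* (n :* u)) refl (fromℕ (suc d)) (fromℕ a) 1/[1+ d ] ⟩
  fromℕ a * (fromℕ (suc d) * 1/[1+ d ]) ≡⟨ cong (fromℕ a *_) (fromℕ-*-1/[1+] d) ⟩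
  fromℕ a * 1ℚ                          ≡⟨ ℚP.*-identityʳ (fromℕ a) ⟩
  fromℕ a                               ≡⟨ /1≡fromℕ a ⟨
  + a / 1                               ∎

-- Exit probabilities

-- Gambler's ruin: the walk of a ball landing with i occupied sites to its left and j to its
-- right leaves the block on the left with probability (j + 1)/(i + j + 2), as in drop1.
exitLeft exitRight : ℕ → ℕ → ℚ
exitLeft  i j = + suc j / (suc i ℕ.+ suc j)
exitRight i j = + suc i / (suc i ℕ.+ suc j)

exitMean : ℕ → ℕ → ℚ → ℚ → ℚ
exitMean i j x y = exitLeft i j * x + exitRight i j * y

exitMean-linear : ∀ i j α β x y x′ y′ →
  exitMean i j (α * x + β * y) (α * x′ + β * y′) ≡ α * exitMean i j x x′ + β * exitMean i j y y′
exitMean-linear i j = solve 8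
  (λ p q α β x y x′ y′ →
    p :* (α :* x :+ β :* y) :+ q :* (α :* x′ :+ β :* y′) := α :* (p :* x :+ q :* x′) :+ β :* (p :* y :+ q :* y′))
  refl (exitLeft i j) (exitRight i j)

exitMean-poly : ∀ i j {d} {I J : ℚ} x y → fromℕ i ≡ I → fromℕ j ≡ J → i ℕ.+ suc j ≡ d →
  exitMean i j x y ≡ ((1ℚ + J) * x + (1ℚ + I) * y) * 1/[1+ d ]
exitMean-poly i j {d} x y refl refl refl = begin
  exitLeft i j * x + exitRight i j * y
    ≡⟨ cong₂ (λ p q → p * x + q * y) (/≡fromℕ-*-1/[1+] (suc j) d) (/≡fromℕ-*-1/[1+] (suc i) d) ⟩
  fromℕ (suc j) * 1/[1+ d ] * x + fromℕ (suc i) * 1/[1+ d ] * y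
    ≡⟨ solve 5 (λ J I u x y → J :* u :* x :+ I :* u :* y := (J :* x :+ I :* y) :* u) refl
         (fromℕ (suc j)) (fromℕ (suc i)) 1/[1+ d ] x y ⟩
  (fromℕ (suc j) * x + fromℕ (suc i) * y) * 1/[1+ d ] ∎

≡-modulo : ∀ {p q d d′} z → p ≡ q + (d ℚ.- d′) * z → d ≡ d′ → p ≡ q
≡-modulo {p} {q} {d′ = d′} z p≡ refl = begin
  p                        ≡⟨ p≡ ⟩
  q + (d′ ℚ.- d′) * z      ≡⟨ cong (λ e → q + e * z) (ℚP.+-inverseʳ d′) ⟩
  q + 0ℚ * z               ≡⟨ cong (ℚ._+_ q) (ℚP.*-zeroˡ z) ⟩
  q + 0ℚ                   ≡⟨ ℚP.+-identityʳ q ⟩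
  q                        ∎

exitMean-comm : ∀ l m i t a b c → l ℕ.+ m ≡ i ℕ.+ t →
  exitMean l m (exitMean (suc i) t a b) (exitMean i (suc t) b c)
    ≡ exitMean i t (exitMean (suc l) m a b) (exitMean l (suc m) b c)
exitMean-comm l m i t a b c l+m≡i+t = begin
  exitMean l m (exitMean (suc i) t a b) (exitMean i (suc t) b c)
    ≡⟨ cong₂ (exitMean l m) (exitMean-poly (suc i) t a b refl refl (cong suc i+1+t≡D))
         (exitMean-poly i (suc t) b c refl refl (trans (ℕP.+-suc i (suc t)) (cong suc i+1+t≡D))) ⟩
  exitMean l m x₁ y₁                    ≡⟨ exitMean-poly l m x₁ y₁ refl refl refl ⟩
  ((1ℚ + M) * x₁ + (1ℚ + L) * y₁) * u
    ≡⟨ ≡-modulo (b * (u * v))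
         -- the coefficients of b on the two sides differ by (l + m) − (i + t)
         (solve 9 (λ L M I T u v a b c →
            ((con 1ℚ :+ M) :* (((con 1ℚ :+ T) :* a :+ (con 1ℚ :+ (con 1ℚ :+ I)) :* b) :* v)
              :+ (con 1ℚ :+ L) :* (((con 1ℚ :+ (con 1ℚ :+ T)) :* b :+ (con 1ℚ :+ I) :* c) :* v)) :* u
            := ((con 1ℚ :+ T) :* (((con 1ℚ :+ M) :* a :+ (con 1ℚ :+ (con 1ℚ :+ L)) :* b) :* v)
                 :+ (con 1ℚ :+ I) :* (((con 1ℚ :+ (con 1ℚ :+ M)) :* b :+ (con 1ℚ :+ L) :* c) :* v)) :* u
               :+ ((L :+ M) :- (I :+ T)) :* (b :* (u :* v)))
           refl L M I T u v a b c)
         (trans (sym (fromℕ-+ l m)) (trans (cong fromℕ l+m≡i+t) (fromℕ-+ i t))) ⟩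
  ((1ℚ + T) * x₂ + (1ℚ + I) * y₂) * u  ≡⟨ exitMean-poly i t x₂ y₂ refl refl i+1+t≡D ⟨
  exitMean i t x₂ y₂
    ≡⟨ cong₂ (exitMean i t) (exitMean-poly (suc l) m a b refl refl refl)
         (exitMean-poly l (suc m) b c refl refl (ℕP.+-suc l (suc m))) ⟨
  exitMean i t (exitMean (suc l) m a b) (exitMean l (suc m) b c) ∎
  where
  L M I T u v x₁ y₁ x₂ y₂ : ℚ
  L = fromℕ l; M = fromℕ m; I = fromℕ i; T = fromℕ t
  u = 1/[1+ l ℕ.+ suc m ]; v = 1/[1+ suc (l ℕ.+ suc m) ]
  x₁ = ((1ℚ + T) * a + (1ℚ + (1ℚ + I)) * b) * v; y₁ = ((1ℚ + (1ℚ + T)) * b + (1ℚ + I) * c) * v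
  x₂ = ((1ℚ + M) * a + (1ℚ + (1ℚ + L)) * b) * v; y₂ = ((1ℚ + (1ℚ + M)) * b + (1ℚ + L) * c) * v
  i+1+t≡D : i ℕ.+ suc t ≡ l ℕ.+ suc m
  i+1+t≡D = trans (ℕP.+-suc i t) (trans (cong suc (sym l+m≡i+t)) (sym (ℕP.+-suc l m)))

exitMean-absorb : ∀ l m {i} b c → i ≡ suc (l ℕ.+ m) →
  exitMean l m b (exitMean i 0 b c) ≡ exitMean l (suc m) b c
exitMean-absorb l m b c refl = begin
  exitMean l m b (exitMean (suc (l ℕ.+ m)) 0 b c)
    ≡⟨ cong (exitMean l m b) (exitMean-poly (suc (l ℕ.+ m)) 0 b c (cong (ℚ._+_ 1ℚ) (fromℕ-+ l m)) refl (size l m)) ⟩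
  exitMean l m b y                      ≡⟨ exitMean-poly l m b y refl refl refl ⟩
  ((1ℚ + M) * b + (1ℚ + L) * y) * u
    ≡⟨ ≡-modulo (- ((1ℚ + M) * u * b)) (≡-modulo ((1ℚ + L) * v * c + (1ℚ + (1ℚ + M)) * v * b)
         -- the difference of the two sides is a combination of u-inv and v-inv
         (solve 6 (λ L M u v b c →
            ((con 1ℚ :+ M) :* b :+ (con 1ℚ :+ L) :* (((con 1ℚ :+ con 0ℚ) :* b :+ (con 1ℚ :+ (con 1ℚ :+ (L :+ M))) :* c) :* v)) :* u
            := (((con 1ℚ :+ (con 1ℚ :+ M)) :* b :+ (con 1ℚ :+ L) :* c) :* v
                 :+ ((con 1ℚ :+ (con 1ℚ :+ (L :+ (con 1ℚ :+ M)))) :* v :- con 1ℚ) :* (:- ((con 1ℚ :+ M) :* u :* b)))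
               :+ ((con 1ℚ :+ (L :+ (con 1ℚ :+ M))) :* u :- con 1ℚ) :* ((con 1ℚ :+ L) :* v :* c :+ (con 1ℚ :+ (con 1ℚ :+ M)) :* v :* b))
           refl L M u v b c)
         u-inv) v-inv ⟩
  ((1ℚ + (1ℚ + M)) * b + (1ℚ + L) * c) * v
    ≡⟨ exitMean-poly l (suc m) b c refl refl (ℕP.+-suc l (suc m)) ⟨
  exitMean l (suc m) b c                ∎
  where
  L M u v y : ℚ
  L = fromℕ l; M = fromℕ m
  u = 1/[1+ l ℕ.+ suc m ]; v = 1/[1+ suc (l ℕ.+ suc m) ]
  y = ((1ℚ + 0ℚ) * b + (1ℚ + (1ℚ + (L + M))) * c) * v
  size : ∀ l m → suc (l ℕ.+ m) ℕ.+ 1 ≡ suc (l ℕ.+ suc m)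
  size = ℕ-Solver.solve-∀
  u-inv : (1ℚ + (L + (1ℚ + M))) * u ≡ 1ℚ
  u-inv = trans (cong (λ z → (1ℚ + z) * u) (sym (fromℕ-+ l (suc m)))) (fromℕ-*-1/[1+] (l ℕ.+ suc m))
  v-inv : (1ℚ + (1ℚ + (L + (1ℚ + M)))) * v ≡ 1ℚ
  v-inv = trans (cong (λ z → (1ℚ + (1ℚ + z)) * v) (sym (fromℕ-+ l (suc m)))) (fromℕ-*-1/[1+] (suc (l ℕ.+ suc m)))

-- The dynamics on a block around the pile site P

-- Functions of the occupied block [P − l, P + m], as functions of (l, m).
BlockFn : Set
BlockFn = ℕ → ℕ → ℚ

data Slot : Set where
  inside   : ℕ → Slot
  adjacent : Slot

-- slot j m: the site P + j seen from the block [P − l, P + m]; inside with t sites to its right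
-- when m = j + t, adjacent when j = m + 1 (also returned, meaninglessly, when j > m + 1).
slot : ℕ → ℕ → Slot
slot zero    m       = inside m
slot (suc j) zero    = adjacent
slot (suc j) (suc m) = slot j m

slot-inside : ∀ j t → slot j (j ℕ.+ t) ≡ inside t
slot-inside zero    t = refl
slot-inside (suc j) t = slot-inside j t

slot-adjacent : ∀ m → slot (suc m) m ≡ adjacent
slot-adjacent zero    = refl
slot-adjacent (suc m) = slot-adjacent m

dropAt : ℕ → BlockFn → BlockFn
dropAt j h l m with slot j m
... | inside t = exitMean (l ℕ.+ j) t (h (suc l) m) (h l (suc m))
... | adjacent = h l (suc m)

dropAt-inside : ∀ {m} j t h l → m ≡ j ℕ.+ t → dropAt j h l m ≡ exitMean (l ℕ.+ j) t (h (suc l) m) (h l (suc m))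
dropAt-inside j t h l refl rewrite slot-inside j t = refl

dropAt-adjacent : ∀ h l m → dropAt (suc m) h l m ≡ h l (suc m)
dropAt-adjacent h l m rewrite slot-adjacent m = refl

dropAt-zero : ∀ h l m → dropAt 0 h l m ≡ exitMean l m (h (suc l) m) (h l (suc m))
dropAt-zero h l m = cong (λ i → exitMean i m (h (suc l) m) (h l (suc m))) (ℕP.+-identityʳ l)

data Placement (j m : ℕ) : Set where
  inside   : ∀ t → m ≡ j ℕ.+ t → Placement j m
  adjacent : j ≡ suc m → Placement j m

placement : ∀ {j m} → j ≤ suc m → Placement j m
placement {zero}  {m}     _           = inside m refl
placement {suc j} {zero}  (ℕ.s≤s ℕ.z≤n) = adjacent refl
placement {suc j} {suc m} (ℕ.s≤s j≤1+m) with placement j≤1+m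
... | inside t m≡j+t = inside t (cong suc m≡j+t)
... | adjacent j≡1+m = adjacent (cong suc j≡1+m)

dropAt-cong : ∀ {j} h h′ l m → j ≤ suc m →
  (j ≤ m → h (suc l) m ≡ h′ (suc l) m) → h l (suc m) ≡ h′ l (suc m) → dropAt j h l m ≡ dropAt j h′ l m
dropAt-cong {j} h h′ l m j≤1+m left right with placement j≤1+m
... | inside t refl = begin
  dropAt j h l (j ℕ.+ t)  ≡⟨ dropAt-inside j t h l refl ⟩
  exitMean (l ℕ.+ j) t (h (suc l) (j ℕ.+ t)) (h l (suc (j ℕ.+ t)))
    ≡⟨ cong₂ (exitMean (l ℕ.+ j) t) (left (ℕP.m≤m+n j t)) right ⟩
  exitMean (l ℕ.+ j) t (h′ (suc l) (j ℕ.+ t)) (h′ l (suc (j ℕ.+ t)))  ≡⟨ dropAt-inside j t h′ l refl ⟨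
  dropAt j h′ l (j ℕ.+ t) ∎
... | adjacent refl = trans (dropAt-adjacent h l m) (trans right (sym (dropAt-adjacent h′ l m)))

dropAt-comm : ∀ {j m} h l → j ≤ suc m → dropAt 0 (dropAt j h) l m ≡ dropAt j (dropAt 0 h) l m
dropAt-comm {j} {m} h l j≤1+m with placement j≤1+m
... | inside t refl = begin
  dropAt 0 (dropAt j h) l (j ℕ.+ t)
    ≡⟨ dropAt-zero (dropAt j h) l (j ℕ.+ t) ⟩
  exitMean l (j ℕ.+ t) (dropAt j h (suc l) (j ℕ.+ t)) (dropAt j h l (suc (j ℕ.+ t)))
    ≡⟨ cong₂ (exitMean l (j ℕ.+ t)) (dropAt-inside j t h (suc l) refl) (dropAt-inside j (suc t) h l (sym (ℕP.+-suc j t))) ⟩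
  exitMean l (j ℕ.+ t) (exitMean (suc (l ℕ.+ j)) t a b) (exitMean (l ℕ.+ j) (suc t) b c)
    ≡⟨ exitMean-comm l (j ℕ.+ t) (l ℕ.+ j) t a b c (sym (ℕP.+-assoc l j t)) ⟩
  exitMean (l ℕ.+ j) t (exitMean (suc l) (j ℕ.+ t) a b) (exitMean l (suc (j ℕ.+ t)) b c)
    ≡⟨ cong₂ (exitMean (l ℕ.+ j) t) (dropAt-zero h (suc l) (j ℕ.+ t)) (dropAt-zero h l (suc (j ℕ.+ t))) ⟨
  exitMean (l ℕ.+ j) t (dropAt 0 h (suc l) (j ℕ.+ t)) (dropAt 0 h l (suc (j ℕ.+ t)))
    ≡⟨ dropAt-inside j t (dropAt 0 h) l refl ⟨
  dropAt j (dropAt 0 h) l (j ℕ.+ t) ∎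
  where
  a b c : ℚ
  a = h (suc (suc l)) (j ℕ.+ t); b = h (suc l) (suc (j ℕ.+ t)); c = h l (suc (suc (j ℕ.+ t)))
... | adjacent refl = begin
  dropAt 0 (dropAt (suc m) h) l m
    ≡⟨ dropAt-zero (dropAt (suc m) h) l m ⟩
  exitMean l m (dropAt (suc m) h (suc l) m) (dropAt (suc m) h l (suc m))
    ≡⟨ cong₂ (exitMean l m) (dropAt-adjacent h (suc l) m) (dropAt-inside (suc m) 0 h l (sym (ℕP.+-identityʳ (suc m)))) ⟩
  exitMean l m b (exitMean (l ℕ.+ suc m) 0 b c)
    ≡⟨ exitMean-absorb l m b c (ℕP.+-suc l m) ⟩
  exitMean l (suc m) b c
    ≡⟨ dropAt-zero h l (suc m) ⟨
  dropAt 0 h l (suc m)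
    ≡⟨ dropAt-adjacent (dropAt 0 h) l m ⟨
  dropAt (suc m) (dropAt 0 h) l m ∎
  where
  b c : ℚ
  b = h (suc l) (suc m); c = h l (suc (suc m))

dropPile : ℕ → BlockFn → BlockFn
dropPile zero    h = h
dropPile (suc N) h = dropAt 0 (dropPile N h)

dropRun : ℕ → ℕ → BlockFn → BlockFn
dropRun j zero    h = h
dropRun j (suc c) h = dropAt j (dropRun (suc j) c h)

dropPile-dropAt : ∀ N {j m} h l → j ≤ suc m → dropPile N (dropAt j h) l m ≡ dropAt j (dropPile N h) l m
dropPile-dropAt zero    h l j≤1+m = refl
dropPile-dropAt (suc N) {j} {m} h l j≤1+m = begin
  dropAt 0 (dropPile N (dropAt j h)) l m
    ≡⟨ dropAt-cong (dropPile N (dropAt j h)) (dropAt j (dropPile N h)) l m ℕ.z≤n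
         (λ _ → dropPile-dropAt N h (suc l) j≤1+m) (dropPile-dropAt N h l (ℕP.m≤n⇒m≤1+n j≤1+m)) ⟩
  dropAt 0 (dropAt j (dropPile N h)) l m    ≡⟨ dropAt-comm (dropPile N h) l j≤1+m ⟩
  dropAt j (dropAt 0 (dropPile N h)) l m    ∎

dropPile-dropRun : ∀ N c {j m} h l → j ≤ suc m → dropPile N (dropRun j c h) l m ≡ dropRun j c (dropPile N h) l m
dropPile-dropRun N zero    h l j≤1+m = refl
dropPile-dropRun N (suc c) {j} {m} h l j≤1+m = begin
  dropPile N (dropAt j (dropRun (suc j) c h)) l _   ≡⟨ dropPile-dropAt N (dropRun (suc j) c h) l j≤1+m ⟩
  dropAt j (dropPile N (dropRun (suc j) c h)) l _
    ≡⟨ dropAt-cong (dropPile N (dropRun (suc j) c h)) (dropRun (suc j) c (dropPile N h)) l m j≤1+m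
         (λ j≤m → dropPile-dropRun N c h (suc l) (ℕ.s≤s j≤m)) (dropPile-dropRun N c h l (ℕ.s≤s j≤1+m)) ⟩
  dropAt j (dropRun (suc j) c (dropPile N h)) l _   ∎

dropRun-adjacent : ∀ c h l m → dropRun (suc m) c h l m ≡ h l (c ℕ.+ m)
dropRun-adjacent zero    h l m = refl
dropRun-adjacent (suc c) h l m = begin
  dropAt (suc m) (dropRun (suc (suc m)) c h) l m  ≡⟨ dropAt-adjacent (dropRun (suc (suc m)) c h) l m ⟩
  dropRun (suc (suc m)) c h l (suc m)             ≡⟨ dropRun-adjacent c h l (suc m) ⟩
  h l (c ℕ.+ suc m)                               ≡⟨ cong (h l) (ℕP.+-suc c m) ⟩
  h l (suc c ℕ.+ m)                               ∎

dropPile-linear : ∀ N {f g h : BlockFn} α β → (∀ l m → h l m ≡ α * f l m + β * g l m) →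
  ∀ l m → dropPile N h l m ≡ α * dropPile N f l m + β * dropPile N g l m
dropPile-linear zero    α β h≡ l m = h≡ l m
dropPile-linear (suc N) {f} {g} {h} α β h≡ l m = begin
  dropAt 0 (dropPile N h) l m
    ≡⟨ dropAt-zero (dropPile N h) l m ⟩
  exitMean l m (dropPile N h (suc l) m) (dropPile N h l (suc m))
    ≡⟨ cong₂ (exitMean l m) (dropPile-linear N α β h≡ (suc l) m) (dropPile-linear N α β h≡ l (suc m)) ⟩
  exitMean l m (α * dropPile N f (suc l) m + β * dropPile N g (suc l) m) (α * dropPile N f l (suc m) + β * dropPile N g l (suc m))
    ≡⟨ exitMean-linear l m α β _ _ _ _ ⟩
  α * exitMean l m (dropPile N f (suc l) m) (dropPile N f l (suc m)) + β * exitMean l m (dropPile N g (suc l) m) (dropPile N g l (suc m))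
    ≡⟨ cong₂ (λ x y → α * x + β * y) (dropAt-zero (dropPile N f) l m) (dropAt-zero (dropPile N g) l m) ⟨
  α * dropAt 0 (dropPile N f) l m + β * dropAt 0 (dropPile N g) l m ∎

δ : ℕ → ℕ → BlockFn
δ a b l m = if does (l ℕ.≟ a) ∧ does (m ℕ.≟ b) then 1ℚ else 0ℚ

δ-off : ∀ {a b l m} → ¬ l ≡ a ⊎ ¬ m ≡ b → δ a b l m ≡ 0ℚ
δ-off {a} {b} {l} {m} (inj₁ l≢a) = cong (λ x → if x ∧ does (m ℕ.≟ b) then 1ℚ else 0ℚ) (dec-false (l ℕ.≟ a) l≢a)
δ-off {a} {b} {l} {m} (inj₂ m≢b) = trans
  (cong (λ x → if does (l ℕ.≟ a) ∧ x then 1ℚ else 0ℚ) (dec-false (m ℕ.≟ b) m≢b))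
  (cong (λ x → if x then 1ℚ else 0ℚ) (∧-zeroʳ (does (l ℕ.≟ a))))

δ-on : ∀ a b → δ a b a b ≡ 1ℚ
δ-on a b = cong₂ (λ x y → if x ∧ y then 1ℚ else 0ℚ) (dec-true (a ℕ.≟ a) refl) (dec-true (b ℕ.≟ b) refl)

*-δ : ∀ (f : BlockFn) a b l m → f l m * δ a b l m ≡ f a b * δ a b l m
*-δ f a b l m with l ℕ.≟ a | m ℕ.≟ b
... | yes refl | yes refl = refl
... | no l≢a   | _        rewrite δ-off {a} {b} {l} {m} (inj₁ l≢a) = trans (ℚP.*-zeroʳ (f l m)) (sym (ℚP.*-zeroʳ (f a b)))
... | yes refl | no m≢b   rewrite δ-off {a} {b} {a} {m} (inj₂ m≢b) = trans (ℚP.*-zeroʳ (f a m)) (sym (ℚP.*-zeroʳ (f a b)))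

dropAt-δ : ∀ a b l m → dropAt 0 (δ (suc a) (suc b)) l m
  ≡ exitLeft a (suc b) * δ a (suc b) l m + exitRight (suc a) b * δ (suc a) b l m
dropAt-δ a b l m = trans (dropAt-zero (δ (suc a) (suc b)) l m)
  (cong₂ _+_ (*-δ exitLeft a (suc b) l m) (*-δ exitRight (suc a) b l m))

dropPile-δ : ∀ N a b l m → dropPile (suc N) (δ (suc a) (suc b)) l m
  ≡ exitLeft a (suc b) * dropPile N (δ a (suc b)) l m + exitRight (suc a) b * dropPile N (δ (suc a) b) l m
dropPile-δ N a b l m = begin
  dropAt 0 (dropPile N (δ (suc a) (suc b))) l m  ≡⟨ dropPile-dropAt N (δ (suc a) (suc b)) l ℕ.z≤n ⟨
  dropPile N (dropAt 0 (δ (suc a) (suc b))) l m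
    ≡⟨ dropPile-linear N (exitLeft a (suc b)) (exitRight (suc a) b) (dropAt-δ a b) l m ⟩
  exitLeft a (suc b) * dropPile N (δ a (suc b)) l m + exitRight (suc a) b * dropPile N (δ (suc a) b) l m ∎

-- Expectations

𝔼 : {A : Set} → Dist A → (A → ℚ) → ℚ
𝔼 []            f = 0ℚ
𝔼 ((a , p) ∷ d) f = p * f a + 𝔼 d f

𝔼-++ : ∀ {A} (d d′ : Dist A) f → 𝔼 (d ++ d′) f ≡ 𝔼 d f + 𝔼 d′ f
𝔼-++ []            d′ f = sym (ℚP.+-identityˡ (𝔼 d′ f))
𝔼-++ ((a , p) ∷ d) d′ f = trans (cong (ℚ._+_ (p * f a)) (𝔼-++ d d′ f)) (sym (ℚP.+-assoc (p * f a) (𝔼 d f) (𝔼 d′ f)))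

𝔼-scale : ∀ {A} p (g : A × ℚ → A × ℚ) → (∀ a q → g (a , q) ≡ (a , p * q)) → ∀ d f → 𝔼 (map g d) f ≡ p * 𝔼 d f
𝔼-scale p g g≡ []            f = sym (ℚP.*-zeroʳ p)
𝔼-scale p g g≡ ((a , q) ∷ d) f rewrite g≡ a q = begin
  p * q * f a + 𝔼 (map g d) f  ≡⟨ cong₂ _+_ (ℚP.*-assoc p q (f a)) (𝔼-scale p g g≡ d f) ⟩
  p * (q * f a) + p * 𝔼 d f    ≡⟨ ℚP.*-distribˡ-+ p (q * f a) (𝔼 d f) ⟨
  p * (q * f a + 𝔼 d f)        ∎

𝔼-bind : ∀ {A B} (d : Dist A) (k : A → Dist B) f → 𝔼 (bind d k) f ≡ 𝔼 d (λ a → 𝔼 (k a) f)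
𝔼-bind []            k f = refl
𝔼-bind ((a , p) ∷ d) k f = trans (𝔼-++ (map _ (k a)) (bind d k) f)
  (cong₂ _+_ (𝔼-scale p _ (λ _ _ → refl) (k a) f) (𝔼-bind d k f))

valueAfter : List ℤ → (Sites → ℚ) → Sites → ℚ
valueAfter []       g   = g
valueAfter (z ∷ zs) g S = 𝔼 (drop1 z S) (valueAfter zs g)

𝔼-dropAll : ∀ zs d g → 𝔼 (foldl (λ d z → bind d (drop1 z)) d zs) g ≡ 𝔼 d (valueAfter zs g)
𝔼-dropAll []       d g = refl
𝔼-dropAll (z ∷ zs) d g = trans (𝔼-dropAll zs (bind d (drop1 z)) g) (𝔼-bind d (drop1 z) (valueAfter zs g))

intervalIndicator : ℕ → Sites → ℚ
intervalIndicator n S = if isInterval n S then 1ℚ else 0ℚ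

Prob≡valueAfter : ∀ c → Prob c ≡ valueAfter (ballSites c) (intervalIndicator (length c)) []
Prob≡valueAfter c = begin
  Prob c                                        ≡⟨ sum≡𝔼 (finalLaw c) ⟩
  𝔼 (finalLaw c) (intervalIndicator n)          ≡⟨ 𝔼-dropAll (ballSites c) _ _ ⟩
  1ℚ * valueAfter (ballSites c) (intervalIndicator n) [] + 0ℚ
    ≡⟨ trans (ℚP.+-identityʳ _) (ℚP.*-identityˡ _) ⟩
  valueAfter (ballSites c) (intervalIndicator n) [] ∎
  where
  n : ℕ
  n = length c
  sum≡𝔼 : ∀ d → foldr _+_ 0ℚ (map (λ { (S , p) → if isInterval n S then p else 0ℚ }) d) ≡ 𝔼 d (intervalIndicator n)
  sum≡𝔼 []            = refl
  sum≡𝔼 ((S , p) ∷ d) = cong₂ _+_ (scale (isInterval n S)) (sum≡𝔼 d)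
    where
    scale : ∀ b → (if b then p else 0ℚ) ≡ p * (if b then 1ℚ else 0ℚ)
    scale true  = sym (ℚP.*-identityʳ p)
    scale false = sym (ℚP.*-zeroʳ p)

-- Blocks of occupied sites

∈ᵇ⇒∈ : ∀ {z S} → Bool.T (z ∈ᵇ S) → z ∈ S
∈ᵇ⇒∈ {S = S} z∈ᵇS = Any.map toWitness (any⁻ _ S z∈ᵇS)

∈⇒∈ᵇ : ∀ {z S} → z ∈ S → z ∈ᵇ S ≡ true
∈⇒∈ᵇ z∈S = Equivalence.to T-≡ (any⁺ _ (Any.map fromWitness z∈S))

∉⇒∈ᵇ : ∀ {z S} → z ∉ S → z ∈ᵇ S ≡ false
∉⇒∈ᵇ {z} {S} z∉S with z ∈ᵇ S in z∈ᵇS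
... | true  = ⊥-elim (z∉S (∈ᵇ⇒∈ (Equivalence.from T-≡ z∈ᵇS)))
... | false = refl

-- The length field makes the fuel length S of runLeft and runRight in drop1 sufficient.
record IsBlock (a : ℤ) (k : ℕ) (S : Sites) : Set where
  field
    length≡  : length S ≡ k
    ∈⇒offset : ∀ {z} → z ∈ S → ∃[ i ] i ℕ.< k × z ≡ a ℤ.+ + i
    offset⇒∈ : ∀ {i} → i ℕ.< k → a ℤ.+ + i ∈ S

open IsBlock

IsBlock-[] : ∀ a → IsBlock a 0 []
IsBlock-[] a = record { length≡ = refl ; ∈⇒offset = λ () ; offset⇒∈ = λ () }

IsBlock-∷ʳ : ∀ {a k S} → IsBlock a k S → IsBlock a (suc k) (a ℤ.+ + k ∷ S)
IsBlock-∷ʳ {a} {k} B = record { length≡ = cong suc (length≡ B) ; ∈⇒offset = offset ; offset⇒∈ = member }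
  where
  offset : ∀ {z} → z ∈ a ℤ.+ + k ∷ _ → ∃[ i ] i ℕ.< suc k × z ≡ a ℤ.+ + i
  offset (here z≡a+k) = k , ℕP.n<1+n k , z≡a+k
  offset (there z∈S)  with i , i<k , z≡a+i ← ∈⇒offset B z∈S = i , ℕP.m<n⇒m<1+n i<k , z≡a+i
  member : ∀ {i} → i ℕ.< suc k → a ℤ.+ + i ∈ a ℤ.+ + k ∷ _
  member i<1+k with ℕP.m≤n⇒m<n∨m≡n (ℕP.≤-pred i<1+k)
  ... | inj₁ i<k = there (offset⇒∈ B i<k)
  ... | inj₂ refl = here refl

private
  shift : ∀ (a x : ℤ) → a ℤ.+ x ≡ (a ℤ.- 1ℤ) ℤ.+ (1ℤ ℤ.+ x)
  shift = ℤ-Solver.solve-∀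

IsBlock-∷ˡ : ∀ {a k S} → IsBlock a k S → IsBlock (a ℤ.- 1ℤ) (suc k) (a ℤ.- 1ℤ ∷ S)
IsBlock-∷ˡ {a} {k} B = record { length≡ = cong suc (length≡ B) ; ∈⇒offset = offset ; offset⇒∈ = member }
  where
  offset : ∀ {z} → z ∈ a ℤ.- 1ℤ ∷ _ → ∃[ i ] i ℕ.< suc k × z ≡ (a ℤ.- 1ℤ) ℤ.+ + i
  offset (here z≡a-1) = 0 , ℕ.z<s , trans z≡a-1 (sym (ℤP.+-identityʳ (a ℤ.- 1ℤ)))
  offset (there z∈S)  with i , i<k , z≡a+i ← ∈⇒offset B z∈S = suc i , ℕ.s<s i<k , trans z≡a+i (shift a (+ i))
  member : ∀ {i} → i ℕ.< suc k → (a ℤ.- 1ℤ) ℤ.+ + i ∈ a ℤ.- 1ℤ ∷ _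
  member {zero}  _             = here (ℤP.+-identityʳ (a ℤ.- 1ℤ))
  member {suc i} (ℕ.s<s i<k) = there (subst (_∈ _) (shift a (+ i)) (offset⇒∈ B i<k))

IsBlock-∉ʳ : ∀ {a k S} → IsBlock a k S → a ℤ.+ + k ∉ S
IsBlock-∉ʳ {a} {k} B a+k∈S with i , i<k , a+k≡a+i ← ∈⇒offset B a+k∈S =
  ℕP.<-irrefl (sym (ℤP.+-injective (ℤ-+-cancelˡ a (+ k) (+ i) a+k≡a+i))) i<k

IsBlock-∉ˡ : ∀ {a k S} → IsBlock a k S → a ℤ.- 1ℤ ∉ S
IsBlock-∉ˡ {a} B a-1∈S with i , _ , a-1≡a+i ← ∈⇒offset B a-1∈S with () ← ℤ-+-cancelˡ a _ (+ i) a-1≡a+i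

runLeft-IsBlock : ∀ {a k S} → IsBlock a k S → ∀ i f → i ℕ.< k → i ≤ f → runLeft f S (a ℤ.+ + i) ≡ i
runLeft-IsBlock B zero zero _ _ = refl
runLeft-IsBlock {a} {S = S} B zero (suc f) _ _ =
  cong (λ b → if b then suc (runLeft f S ((a ℤ.+ + 0) ℤ.- 1ℤ)) else zero)
    (∉⇒∈ᵇ (subst (λ z → z ℤ.- 1ℤ ∉ S) (sym (ℤP.+-identityʳ a)) (IsBlock-∉ˡ B)))
runLeft-IsBlock {a} {k} {S} B (suc i) (suc f) i+1<k (ℕ.s≤s i≤f) = begin
  (if ((a ℤ.+ + suc i) ℤ.- 1ℤ) ∈ᵇ S then suc (runLeft f S ((a ℤ.+ + suc i) ℤ.- 1ℤ)) else zero)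
    ≡⟨ cong (λ b → if b then suc (runLeft f S ((a ℤ.+ + suc i) ℤ.- 1ℤ)) else zero)
         (∈⇒∈ᵇ (subst (_∈ S) (predecessor a (+ i)) (offset⇒∈ B i<k))) ⟩
  suc (runLeft f S ((a ℤ.+ + suc i) ℤ.- 1ℤ))  ≡⟨ cong (λ z → suc (runLeft f S z)) (predecessor a (+ i)) ⟨
  suc (runLeft f S (a ℤ.+ + i))              ≡⟨ cong suc (runLeft-IsBlock B i f i<k i≤f) ⟩
  suc i                                      ∎
  where
  i<k : i ℕ.< k
  i<k = ℕP.<-trans (ℕP.n<1+n i) i+1<k
  predecessor : ∀ (a x : ℤ) → a ℤ.+ x ≡ (a ℤ.+ (1ℤ ℤ.+ x)) ℤ.- 1ℤ
  predecessor = ℤ-Solver.solve-∀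

runRight-IsBlock : ∀ {a S} i j → IsBlock a (i ℕ.+ suc j) S → ∀ f → j ≤ f → runRight f S (a ℤ.+ + i) ≡ j
runRight-IsBlock i zero B zero _ = refl
runRight-IsBlock {a} {S} i zero B (suc f) _ =
  cong (λ b → if b then suc (runRight f S ((a ℤ.+ + i) ℤ.+ 1ℤ)) else zero)
    (∉⇒∈ᵇ (subst (_∉ S) (sym (ℤP.+-assoc a (+ i) 1ℤ)) (IsBlock-∉ʳ B)))
runRight-IsBlock {a} {S} i (suc j) B (suc f) (ℕ.s≤s j≤f) = begin
  (if ((a ℤ.+ + i) ℤ.+ 1ℤ) ∈ᵇ S then suc (runRight f S ((a ℤ.+ + i) ℤ.+ 1ℤ)) else zero)
    ≡⟨ cong (λ b → if b then suc (runRight f S ((a ℤ.+ + i) ℤ.+ 1ℤ)) else zero)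
         (∈⇒∈ᵇ (subst (_∈ S) (successor a (+ i)) (offset⇒∈ B i+1<k))) ⟩
  suc (runRight f S ((a ℤ.+ + i) ℤ.+ 1ℤ))  ≡⟨ cong (λ z → suc (runRight f S z)) (successor a (+ i)) ⟨
  suc (runRight f S (a ℤ.+ + suc i))        ≡⟨ cong suc (runRight-IsBlock (suc i) j B′ f j≤f) ⟩
  suc j                                     ∎
  where
  i+1<k : suc i ℕ.< i ℕ.+ suc (suc j)
  i+1<k = subst (suc i ℕ.<_) (sym (ℕP.+-suc i (suc j))) (ℕP.m<m+n (suc i) ℕ.z<s)
  B′ : IsBlock a (suc i ℕ.+ suc j) S
  B′ = subst (λ k → IsBlock a k S) (ℕP.+-suc i (suc j)) B
  successor : ∀ (a x : ℤ) → a ℤ.+ (1ℤ ℤ.+ x) ≡ (a ℤ.+ x) ℤ.+ 1ℤ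
  successor = ℤ-Solver.solve-∀

𝔼-drop1-∉ : ∀ {z S} h → z ∉ S → 𝔼 (drop1 z S) h ≡ h (z ∷ S)
𝔼-drop1-∉ h z∉S rewrite ∉⇒∈ᵇ z∉S = trans (ℚP.+-identityʳ _) (ℚP.*-identityˡ _)

𝔼-drop1-IsBlock : ∀ {a S} i j h → IsBlock a (i ℕ.+ suc j) S →
  𝔼 (drop1 (a ℤ.+ + i) S) h ≡ exitMean i j (h (a ℤ.- 1ℤ ∷ S)) (h (a ℤ.+ + (i ℕ.+ suc j) ∷ S))
𝔼-drop1-IsBlock {a} {S} i j h B
  rewrite ∈⇒∈ᵇ (offset⇒∈ B (ℕP.m<m+n i ℕ.z<s)) | length≡ B
        | runLeft-IsBlock B i (i ℕ.+ suc j) (ℕP.m<m+n i ℕ.z<s) (ℕP.m≤m+n i (suc j))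
        | runRight-IsBlock i j B (i ℕ.+ suc j) (ℕP.≤-trans (ℕP.n≤1+n j) (ℕP.m≤n+m (suc j) i))
  = trans (cong (ℚ._+_ (exitLeft i j * h ((a ℤ.+ + i) ℤ.- + suc i ∷ S))) (ℚP.+-identityʳ _))
      (cong₂ (λ x y → exitMean i j (h (x ∷ S)) (h (y ∷ S))) (left-neighbour a (+ i)) (ℤP.+-assoc a (+ i) (+ suc j)))
  where
  left-neighbour : ∀ (a x : ℤ) → (a ℤ.+ x) ℤ.- (1ℤ ℤ.+ x) ≡ a ℤ.- 1ℤ
  left-neighbour = ℤ-Solver.solve-∀

-- Simulating drop1 by the block dynamics

Block : ℕ → ℕ → ℕ → Sites → Set
Block P l m S = IsBlock (+ P ℤ.- + l) (l ℕ.+ suc m) S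

private
  left-end : ∀ (P L : ℤ) → (P ℤ.- L) ℤ.- 1ℤ ≡ P ℤ.- (1ℤ ℤ.+ L)
  left-end = ℤ-Solver.solve-∀

  site : ∀ (P L K : ℤ) → (P ℤ.- L) ℤ.+ (L ℤ.+ K) ≡ K ℤ.+ P
  site = ℤ-Solver.solve-∀

Block-growˡ : ∀ {P l m S} → Block P l m S → Block P (suc l) m (+ P ℤ.- + suc l ∷ S)
Block-growˡ {P} {l} {m} {S} B = subst (λ a → IsBlock a (suc (l ℕ.+ suc m)) (a ∷ S)) (left-end (+ P) (+ l)) (IsBlock-∷ˡ B)

Block-growʳ : ∀ {P l m S} → Block P l m S → Block P l (suc m) (+ (suc m ℕ.+ P) ∷ S)
Block-growʳ {P} {l} {m} {S} B =
  subst₂ (λ z k → IsBlock (+ P ℤ.- + l) k (z ∷ S)) (site (+ P) (+ l) (+ suc m)) (sym (ℕP.+-suc l (suc m))) (IsBlock-∷ʳ B)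

𝔼-drop1-inside : ∀ {P l m S} j t h → Block P l m S → m ≡ j ℕ.+ t →
  𝔼 (drop1 (+ (j ℕ.+ P)) S) h ≡ exitMean (l ℕ.+ j) t (h (+ P ℤ.- + suc l ∷ S)) (h (+ (suc m ℕ.+ P) ∷ S))
𝔼-drop1-inside {P} {l} {_} {S} j t h B refl = begin
  𝔼 (drop1 (+ (j ℕ.+ P)) S) h                 ≡⟨ cong (λ z → 𝔼 (drop1 z S) h) (site (+ P) (+ l) (+ j)) ⟨
  𝔼 (drop1 (a ℤ.+ + (l ℕ.+ j)) S) h
    ≡⟨ 𝔼-drop1-IsBlock (l ℕ.+ j) t h (subst (λ k → IsBlock a k S) (size l j t) B) ⟩
  exitMean (l ℕ.+ j) t (h (a ℤ.- 1ℤ ∷ S)) (h (a ℤ.+ + (l ℕ.+ j ℕ.+ suc t) ∷ S))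
    ≡⟨ cong₂ (λ x y → exitMean (l ℕ.+ j) t (h (x ∷ S)) (h (y ∷ S)))
         (left-end (+ P) (+ l)) (trans (cong (λ k → a ℤ.+ + k) (sym (size l j t))) (site (+ P) (+ l) (+ suc (j ℕ.+ t)))) ⟩
  exitMean (l ℕ.+ j) t (h (+ P ℤ.- + suc l ∷ S)) (h (+ (suc (j ℕ.+ t) ℕ.+ P) ∷ S)) ∎
  where
  a : ℤ
  a = + P ℤ.- + l
  size : ∀ l j t → l ℕ.+ suc (j ℕ.+ t) ≡ l ℕ.+ j ℕ.+ suc t
  size = ℕ-Solver.solve-∀

𝔼-drop1-adjacent : ∀ {P l m S} h → Block P l m S → 𝔼 (drop1 (+ (suc m ℕ.+ P)) S) h ≡ h (+ (suc m ℕ.+ P) ∷ S)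
𝔼-drop1-adjacent {P} {l} {m} {S} h B = 𝔼-drop1-∉ h (subst (_∉ S) (site (+ P) (+ l) (+ suc m)) (IsBlock-∉ʳ B))

valueAfter-dropAt : ∀ {P l m S j} zs g (G : BlockFn) → Block P l m S → j ≤ suc m →
  (j ≤ m → valueAfter zs g (+ P ℤ.- + suc l ∷ S) ≡ G (suc l) m) →
  valueAfter zs g (+ (suc m ℕ.+ P) ∷ S) ≡ G l (suc m) →
  valueAfter (+ (j ℕ.+ P) ∷ zs) g S ≡ dropAt j G l m
valueAfter-dropAt {P} {l} {m} {S} {j} zs g G B j≤1+m left right with placement j≤1+m
... | inside t m≡j+t = begin
  𝔼 (drop1 (+ (j ℕ.+ P)) S) (valueAfter zs g)
    ≡⟨ 𝔼-drop1-inside j t (valueAfter zs g) B m≡j+t ⟩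
  exitMean (l ℕ.+ j) t (valueAfter zs g (+ P ℤ.- + suc l ∷ S)) (valueAfter zs g (+ (suc m ℕ.+ P) ∷ S))
    ≡⟨ cong₂ (exitMean (l ℕ.+ j) t) (left (subst (j ≤_) (sym m≡j+t) (ℕP.m≤m+n j t))) right ⟩
  exitMean (l ℕ.+ j) t (G (suc l) m) (G l (suc m))
    ≡⟨ dropAt-inside j t G l m≡j+t ⟨
  dropAt j G l m ∎
... | adjacent refl = trans (𝔼-drop1-adjacent (valueAfter zs g) B) (trans right (sym (dropAt-adjacent G l m)))

isInterval-IsBlock : ∀ {a n S} → IsBlock a n S → 0 ℕ.< n → Bool.T (isInterval n S) ⇔ a ≡ + 1
isInterval-IsBlock {a} {n} {S} B 0<n = mk⇔ ⇒ ⇐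
  where
  ⇒ : Bool.T (isInterval n S) → a ≡ + 1
  ⇒ interval with covered , inRange ← Equivalence.to T-∧ interval = ℤP.≤-antisym a≤1 1≤a
    where
    a≤1 : a ℤ.≤ + 1
    a≤1 with i , _ , 1≡a+i ← ∈⇒offset B (∈ᵇ⇒∈ (applyUpTo⁻ _ n (all⁺ _ (upTo n) covered) 0<n)) =
      subst (a ℤ.≤_) (sym 1≡a+i) (ℤP.i≤i+j a (+ i))
    1≤a : + 1 ℤ.≤ a
    1≤a = toWitness {a? = 1ℤ ℤ.≤? a} (proj₁ (Equivalence.to T-∧
      (All.lookup (all⁺ _ S inRange) (subst (_∈ S) (ℤP.+-identityʳ a) (offset⇒∈ B 0<n)))))
  ⇐ : a ≡ + 1 → Bool.T (isInterval n S)
  ⇐ refl = Equivalence.from T-∧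
    ( all⁻ _ (applyUpTo⁺₁ _ n (λ i<n → Equivalence.from T-≡ (∈⇒∈ᵇ (offset⇒∈ B i<n))))
    , all⁻ _ (All.tabulate inRange) )
    where
    inRange : ∀ {z} → z ∈ S → Bool.T (⌊ 1ℤ ℤ.≤? z ⌋ ∧ ⌊ z ℤ.≤? + n ⌋)
    inRange z∈S with i , i<n , refl ← ∈⇒offset B z∈S =
      Equivalence.from T-∧ ( fromWitness {a? = 1ℤ ℤ.≤? + suc i} (ℤ.+≤+ (ℕ.s≤s ℕ.z≤n))
                           , fromWitness {a? = + suc i ℤ.≤? + n} (ℤ.+≤+ i<n) )

intervalIndicator-Block : ∀ {T M l m S} → Block (suc T) l m S → l ℕ.+ suc m ≡ T ℕ.+ suc M →
  intervalIndicator (T ℕ.+ suc M) S ≡ δ T M l m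
intervalIndicator-Block {T} {M} {l} {m} {S} B count
  with l ℕ.≟ T | isInterval-IsBlock (subst (λ k → IsBlock (+ suc T ℤ.- + l) k S) count B) (subst (0 ℕ.<_) (sym (ℕP.+-suc T M)) ℕ.z<s)
... | yes refl | interval with refl ← ℕP.suc-injective (ℕP.+-cancelˡ-≡ T (suc m) (suc M) count) = begin
  (if isInterval (T ℕ.+ suc M) S then 1ℚ else 0ℚ)
    ≡⟨ cong (λ b → if b then 1ℚ else 0ℚ) (Equivalence.to T-≡ (Equivalence.from interval (left-end-one (+ T)))) ⟩
  1ℚ          ≡⟨ δ-on T M ⟨
  δ T M T M   ∎
  where
  left-end-one : ∀ (T : ℤ) → (1ℤ ℤ.+ T) ℤ.- T ≡ 1ℤ
  left-end-one = ℤ-Solver.solve-∀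
... | no l≢T | interval = begin
  (if isInterval (T ℕ.+ suc M) S then 1ℚ else 0ℚ)
    ≡⟨ cong (λ b → if b then 1ℚ else 0ℚ) (¬-not (l≢T ∘ left-end-one⁻¹ ∘ Equivalence.to interval ∘ Equivalence.from T-≡)) ⟩
  0ℚ          ≡⟨ δ-off {T} {M} {l} {m} (inj₁ l≢T) ⟨
  δ T M l m   ∎
  where
  left-end-one⁻¹ : + suc T ℤ.- + l ≡ + 1 → l ≡ T
  left-end-one⁻¹ eq = ℕP.suc-injective (ℤP.+-injective (sym (trans (minus-plus (+ suc T) (+ l)) (cong (ℤ._+ + l) eq))))
    where
    minus-plus : ∀ (P L : ℤ) → P ≡ (P ℤ.- L) ℤ.+ L
    minus-plus = ℤ-Solver.solve-∀

consecutive : ℤ → ℕ → List ℤ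
consecutive z zero    = []
consecutive z (suc c) = z ∷ consecutive (ℤ.suc z) c

valueAfter-settle : ∀ c {a k S} zs g {v} → IsBlock a k S →
  (∀ {S′} → IsBlock a (c ℕ.+ k) S′ → valueAfter zs g S′ ≡ v) →
  valueAfter (consecutive (a ℤ.+ + k) c ++ zs) g S ≡ v
valueAfter-settle zero    zs g B settled = settled B
valueAfter-settle (suc c) {a} {k} {S} zs g B settled = begin
  𝔼 (drop1 (a ℤ.+ + k) S) (valueAfter (consecutive (ℤ.suc (a ℤ.+ + k)) c ++ zs) g)
    ≡⟨ 𝔼-drop1-∉ _ (IsBlock-∉ʳ B) ⟩
  valueAfter (consecutive (ℤ.suc (a ℤ.+ + k)) c ++ zs) g (a ℤ.+ + k ∷ S)
    ≡⟨ cong (λ z → valueAfter (consecutive z c ++ zs) g (a ℤ.+ + k ∷ S)) (next a (+ k)) ⟩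
  valueAfter (consecutive (a ℤ.+ + suc k) c ++ zs) g (a ℤ.+ + k ∷ S)
    ≡⟨ valueAfter-settle c zs g (IsBlock-∷ʳ B) (λ {S′} → settled ∘ subst (λ k → IsBlock a k S′) (ℕP.+-suc c k)) ⟩
  _ ∎
  where
  next : ∀ (a x : ℤ) → 1ℤ ℤ.+ (a ℤ.+ x) ≡ a ℤ.+ (1ℤ ℤ.+ x)
  next = ℤ-Solver.solve-∀

valueAfter-run : ∀ {T M} c {j l m S} → Block (suc T) l m S → j ≤ suc m → c ℕ.+ (l ℕ.+ suc m) ≡ T ℕ.+ suc M →
  valueAfter (consecutive (+ (j ℕ.+ suc T)) c) (intervalIndicator (T ℕ.+ suc M)) S ≡ dropRun j c (δ T M) l m
valueAfter-run zero    B j≤1+m count = intervalIndicator-Block B count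
valueAfter-run {T} {M} (suc c) {j} {l} {m} B j≤1+m count =
  valueAfter-dropAt (consecutive (+ (suc j ℕ.+ suc T)) c) (intervalIndicator (T ℕ.+ suc M)) (dropRun (suc j) c (δ T M)) B j≤1+m
  (λ j≤m → valueAfter-run c (Block-growˡ B) (ℕ.s≤s j≤m) (trans (ℕP.+-suc c (l ℕ.+ suc m)) count))
  (valueAfter-run c (Block-growʳ B) (ℕ.s≤s j≤1+m)
    (trans (cong (c ℕ.+_) (ℕP.+-suc l (suc m))) (trans (ℕP.+-suc c (l ℕ.+ suc m)) count)))

valueAfter-pile : ∀ {T M} N x {l m S} → Block (suc T) l m S → N ℕ.+ (x ℕ.+ (l ℕ.+ suc m)) ≡ T ℕ.+ suc M →
  valueAfter (replicate N (+ suc T) ++ consecutive (+ suc (suc T)) x) (intervalIndicator (T ℕ.+ suc M)) S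
    ≡ dropPile N (dropRun 1 x (δ T M)) l m
valueAfter-pile zero    x B count = valueAfter-run x B (ℕ.s≤s ℕ.z≤n) count
valueAfter-pile {T} {M} (suc N) x {l} {m} B count =
  valueAfter-dropAt (replicate N (+ suc T) ++ consecutive (+ suc (suc T)) x) (intervalIndicator (T ℕ.+ suc M))
    (dropPile N (dropRun 1 x (δ T M))) B ℕ.z≤n
  (λ _ → valueAfter-pile N x (Block-growˡ B) (trans (grow (l ℕ.+ suc m)) count))
  (valueAfter-pile N x (Block-growʳ B)
    (trans (cong (λ k → N ℕ.+ (x ℕ.+ k)) (ℕP.+-suc l (suc m))) (trans (grow (l ℕ.+ suc m)) count)))
  where
  grow : ∀ k → N ℕ.+ (x ℕ.+ suc k) ≡ suc (N ℕ.+ (x ℕ.+ k))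
  grow k = trans (cong (N ℕ.+_) (ℕP.+-suc x k)) (ℕP.+-suc N (x ℕ.+ k))

sitesFrom : ℕ → Config → List ℤ
sitesFrom o []      = []
sitesFrom o (k ∷ c) = replicate k (+ suc o) ++ sitesFrom (suc o) c

ballSites≡sitesFrom : ∀ c → ballSites c ≡ sitesFrom 0 c
ballSites≡sitesFrom c = go id 0 (λ _ → refl) c
  where
  go : ∀ (f : ℕ → ℕ) o → (∀ i → f i ≡ o ℕ.+ i) → ∀ c →
    concat (map (λ { (i , k) → replicate k (+ suc i) }) (zip (applyUpTo f (length c)) c)) ≡ sitesFrom o c
  go f o f≡ []      = refl
  go f o f≡ (k ∷ c) = cong₂ (λ i rest → replicate k (+ suc i) ++ rest)
    (trans (f≡ 0) (ℕP.+-identityʳ o)) (go (f ∘ suc) (suc o) (λ i → trans (f≡ (suc i)) (ℕP.+-suc o i)) c)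

sitesFrom-zeros : ∀ r o c → sitesFrom o (replicate r 0 ++ c) ≡ sitesFrom (r ℕ.+ o) c
sitesFrom-zeros zero    o c = refl
sitesFrom-zeros (suc r) o c = trans (sitesFrom-zeros r (suc o) c) (cong (λ o → sitesFrom o c) (ℕP.+-suc r o))

sitesFrom-ones : ∀ m o c → sitesFrom o (replicate m 1 ++ c) ≡ consecutive (+ suc o) m ++ sitesFrom (m ℕ.+ o) c
sitesFrom-ones zero    o c = refl
sitesFrom-ones (suc m) o c = cong (+ suc o ∷_)
  (trans (sitesFrom-ones m (suc o) c) (cong (λ o′ → consecutive (+ suc (suc o)) m ++ sitesFrom o′ c) (ℕP.+-suc m o)))

ballSites-conf : ∀ r s x y → ballSites (conf r s (suc x) (suc y))
  ≡ consecutive (+ suc r) y ++ (+ suc (y ℕ.+ r) ∷ replicate (r ℕ.+ s) (+ suc (y ℕ.+ r)) ++ consecutive (+ suc (suc (y ℕ.+ r))) x)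
ballSites-conf r s x y = begin
  ballSites (conf r s (suc x) (suc y))
    ≡⟨ ballSites≡sitesFrom (conf r s (suc x) (suc y)) ⟩
  sitesFrom 0 (replicate r 0 ++ replicate y 1 ++ (r ℕ.+ s ℕ.+ 1) ∷ replicate x 1 ++ replicate s 0)
    ≡⟨ sitesFrom-zeros r 0 _ ⟩
  sitesFrom (r ℕ.+ 0) (replicate y 1 ++ (r ℕ.+ s ℕ.+ 1) ∷ replicate x 1 ++ replicate s 0)
    ≡⟨ cong (λ o → sitesFrom o (replicate y 1 ++ (r ℕ.+ s ℕ.+ 1) ∷ replicate x 1 ++ replicate s 0)) (ℕP.+-identityʳ r) ⟩
  sitesFrom r (replicate y 1 ++ (r ℕ.+ s ℕ.+ 1) ∷ replicate x 1 ++ replicate s 0)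
    ≡⟨ sitesFrom-ones y r _ ⟩
  consecutive (+ suc r) y ++ replicate (r ℕ.+ s ℕ.+ 1) P ++ sitesFrom (suc (y ℕ.+ r)) (replicate x 1 ++ replicate s 0)
    ≡⟨ cong₂ (λ k rest → consecutive (+ suc r) y ++ replicate k P ++ rest) (ℕP.+-comm (r ℕ.+ s) 1) ones ⟩
  consecutive (+ suc r) y ++ (P ∷ replicate (r ℕ.+ s) P ++ consecutive (+ suc (suc (y ℕ.+ r))) x) ∎
  where
  P : ℤ
  P = + suc (y ℕ.+ r)
  ones : sitesFrom (suc (y ℕ.+ r)) (replicate x 1 ++ replicate s 0) ≡ consecutive (+ suc (suc (y ℕ.+ r))) x
  ones = begin
    sitesFrom (suc (y ℕ.+ r)) (replicate x 1 ++ replicate s 0)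
      ≡⟨ sitesFrom-ones x _ _ ⟩
    consecutive (+ suc (suc (y ℕ.+ r))) x ++ sitesFrom (x ℕ.+ suc (y ℕ.+ r)) (replicate s 0)
      ≡⟨ cong (λ c → consecutive _ x ++ sitesFrom _ c) (LP.++-identityʳ (replicate s 0)) ⟨
    consecutive (+ suc (suc (y ℕ.+ r))) x ++ sitesFrom (x ℕ.+ suc (y ℕ.+ r)) (replicate s 0 ++ [])
      ≡⟨ cong (consecutive _ x ++_) (sitesFrom-zeros s _ []) ⟩
    consecutive (+ suc (suc (y ℕ.+ r))) x ++ []
      ≡⟨ LP.++-identityʳ _ ⟩
    consecutive (+ suc (suc (y ℕ.+ r))) x ∎

length-conf : ∀ r s x y → length (conf r s (suc x) (suc y)) ≡ y ℕ.+ r ℕ.+ suc (x ℕ.+ s)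
length-conf r s x y = begin
  length (replicate r 0 ++ replicate y 1 ++ (r ℕ.+ s ℕ.+ 1) ∷ replicate x 1 ++ replicate s 0)
    ≡⟨ length-replicate-++ r _ ⟩
  r ℕ.+ length (replicate y 1 ++ (r ℕ.+ s ℕ.+ 1) ∷ replicate x 1 ++ replicate s 0)
    ≡⟨ cong (r ℕ.+_) (length-replicate-++ y _) ⟩
  r ℕ.+ (y ℕ.+ suc (length (replicate x 1 ++ replicate s 0)))
    ≡⟨ cong (λ n → r ℕ.+ (y ℕ.+ suc n)) (trans (length-replicate-++ x _) (cong (x ℕ.+_) (LP.length-replicate s))) ⟩
  r ℕ.+ (y ℕ.+ suc (x ℕ.+ s))
    ≡⟨ reorder r s x y ⟩
  y ℕ.+ r ℕ.+ suc (x ℕ.+ s) ∎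
  where
  length-replicate-++ : ∀ k {a : ℕ} xs → length (replicate k a ++ xs) ≡ k ℕ.+ length xs
  length-replicate-++ zero    xs = refl
  length-replicate-++ (suc k) xs = cong suc (length-replicate-++ k xs)
  reorder : ∀ r s x y → r ℕ.+ (y ℕ.+ suc (x ℕ.+ s)) ≡ y ℕ.+ r ℕ.+ suc (x ℕ.+ s)
  reorder = ℕ-Solver.solve-∀

Prob-conf≡dropPile : ∀ r s x y → Prob (conf r s (suc x) (suc y)) ≡ dropPile (r ℕ.+ s) (δ (y ℕ.+ r) (x ℕ.+ s)) y x
Prob-conf≡dropPile r s x y = begin
  Prob c                                                       ≡⟨ Prob≡valueAfter c ⟩
  valueAfter (ballSites c) (intervalIndicator (length c)) []
    ≡⟨ cong₂ (λ zs n → valueAfter zs (intervalIndicator n) []) (ballSites-conf r s x y) (length-conf r s x y) ⟩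
  valueAfter (consecutive (+ suc r) y ++ P ∷ rest) g []
    ≡⟨ cong (λ z → valueAfter (consecutive z y ++ P ∷ rest) g []) (ℤP.+-identityʳ (+ suc r)) ⟨
  valueAfter (consecutive (+ suc r ℤ.+ + 0) y ++ P ∷ rest) g []
    ≡⟨ valueAfter-settle y (P ∷ rest) g (IsBlock-[] (+ suc r)) pile ⟩
  dropPile (r ℕ.+ s) (dropRun 1 x (δ T M)) y 0                 ≡⟨ dropPile-dropRun (r ℕ.+ s) x (δ T M) y (ℕ.s≤s ℕ.z≤n) ⟩
  dropRun 1 x (dropPile (r ℕ.+ s) (δ T M)) y 0                 ≡⟨ dropRun-adjacent x (dropPile (r ℕ.+ s) (δ T M)) y 0 ⟩
  dropPile (r ℕ.+ s) (δ T M) y (x ℕ.+ 0)                       ≡⟨ cong (dropPile (r ℕ.+ s) (δ T M) y) (ℕP.+-identityʳ x) ⟩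
  dropPile (r ℕ.+ s) (δ T M) y x                               ∎
  where
  c : Config
  c = conf r s (suc x) (suc y)
  T M : ℕ
  T = y ℕ.+ r
  M = x ℕ.+ s
  P : ℤ
  P = + suc T
  rest : List ℤ
  rest = replicate (r ℕ.+ s) P ++ consecutive (+ suc (suc T)) x
  g : Sites → ℚ
  g = intervalIndicator (T ℕ.+ suc M)
  pile-site : + suc r ℤ.+ + (y ℕ.+ 0) ≡ P
  pile-site = cong (λ n → + suc n) (reorder r y)
    where
    reorder : ∀ r y → r ℕ.+ (y ℕ.+ 0) ≡ y ℕ.+ r
    reorder = ℕ-Solver.solve-∀
  pile-block : ∀ {S₀} → IsBlock (+ suc r) (y ℕ.+ 0) S₀ → Block (suc T) y 0 (P ∷ S₀)
  pile-block {S₀} B₀ = subst₂ (λ a k → IsBlock a k (P ∷ S₀)) (lower (+ y) (+ r)) (size y)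
    (subst (λ z → IsBlock (+ suc r) (suc (y ℕ.+ 0)) (z ∷ S₀)) pile-site (IsBlock-∷ʳ B₀))
    where
    lower : ∀ (Y R : ℤ) → 1ℤ ℤ.+ R ≡ (1ℤ ℤ.+ (Y ℤ.+ R)) ℤ.- Y
    lower = ℤ-Solver.solve-∀
    size : ∀ y → suc (y ℕ.+ 0) ≡ y ℕ.+ 1
    size = ℕ-Solver.solve-∀
  count : r ℕ.+ s ℕ.+ (x ℕ.+ (y ℕ.+ 1)) ≡ T ℕ.+ suc M
  count = reorder r s x y
    where
    reorder : ∀ r s x y → r ℕ.+ s ℕ.+ (x ℕ.+ (y ℕ.+ 1)) ≡ y ℕ.+ r ℕ.+ suc (x ℕ.+ s)
    reorder = ℕ-Solver.solve-∀
  pile : ∀ {S₀} → IsBlock (+ suc r) (y ℕ.+ 0) S₀ →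
    valueAfter (P ∷ rest) g S₀ ≡ dropPile (r ℕ.+ s) (dropRun 1 x (δ T M)) y 0
  pile {S₀} B₀ = trans (𝔼-drop1-∉ _ (subst (_∉ S₀) pile-site (IsBlock-∉ʳ B₀)))
    (valueAfter-pile (r ℕ.+ s) x (pile-block B₀) count)

Prob-recurrence : ∀ r s x y → Prob (conf (suc r) (suc s) (suc x) (suc y))
  ≡ exitLeft (y ℕ.+ r) (suc (x ℕ.+ s)) * Prob (conf r (suc s) (suc x) (suc y))
    + exitRight (suc (y ℕ.+ r)) (x ℕ.+ s) * Prob (conf (suc r) s (suc x) (suc y))
Prob-recurrence r s x y = begin
  Prob (conf (suc r) (suc s) (suc x) (suc y))
    ≡⟨ Prob-conf≡dropPile (suc r) (suc s) x y ⟩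
  dropPile (suc (r ℕ.+ suc s)) (δ (y ℕ.+ suc r) (x ℕ.+ suc s)) y x
    ≡⟨ cong₂ (λ a b → dropPile (suc (r ℕ.+ suc s)) (δ a b) y x) (ℕP.+-suc y r) (ℕP.+-suc x s) ⟩
  dropPile (suc (r ℕ.+ suc s)) (δ (suc (y ℕ.+ r)) (suc (x ℕ.+ s))) y x
    ≡⟨ dropPile-δ (r ℕ.+ suc s) (y ℕ.+ r) (x ℕ.+ s) y x ⟩
  exitLeft (y ℕ.+ r) (suc (x ℕ.+ s)) * dropPile (r ℕ.+ suc s) (δ (y ℕ.+ r) (suc (x ℕ.+ s))) y x
    + exitRight (suc (y ℕ.+ r)) (x ℕ.+ s) * dropPile (r ℕ.+ suc s) (δ (suc (y ℕ.+ r)) (x ℕ.+ s)) y x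
    ≡⟨ cong₂ (λ p q → exitLeft (y ℕ.+ r) (suc (x ℕ.+ s)) * p + exitRight (suc (y ℕ.+ r)) (x ℕ.+ s) * q)
         (trans (Prob-conf≡dropPile r (suc s) x y) (cong (λ b → dropPile (r ℕ.+ suc s) (δ (y ℕ.+ r) b) y x) (ℕP.+-suc x s)))
         (trans (Prob-conf≡dropPile (suc r) s x y)
           (cong₂ (λ N a → dropPile N (δ a (x ℕ.+ s)) y x) (sym (ℕP.+-suc r s)) (ℕP.+-suc y r))) ⟨
  exitLeft (y ℕ.+ r) (suc (x ℕ.+ s)) * Prob (conf r (suc s) (suc x) (suc y))
    + exitRight (suc (y ℕ.+ r)) (x ℕ.+ s) * Prob (conf (suc r) s (suc x) (suc y)) ∎

size*Prob-recurrence : ∀ r s x y → let n = y ℕ.+ r ℕ.+ suc (x ℕ.+ suc s) in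
  + suc n / 1 * Prob (conf (suc r) (suc s) (suc x) (suc y))
    ≡ + (suc s ℕ.+ suc x) / 1 * Prob (conf r (suc s) (suc x) (suc y))
      + + (suc r ℕ.+ suc y) / 1 * Prob (conf (suc r) s (suc x) (suc y))
size*Prob-recurrence r s x y = begin
  N * Prob (conf (suc r) (suc s) (suc x) (suc y))  ≡⟨ cong (N *_) (Prob-recurrence r s x y) ⟩
  N * (eˡ * P₁ + eʳ * P₂)                          ≡⟨ ℚP.*-distribˡ-+ N (eˡ * P₁) (eʳ * P₂) ⟩
  N * (eˡ * P₁) + N * (eʳ * P₂)                    ≡⟨ cong₂ _+_ (ℚP.*-assoc N eˡ P₁) (ℚP.*-assoc N eʳ P₂) ⟨
  N * eˡ * P₁ + N * eʳ * P₂
    ≡⟨ cong₂ (λ p q → p * P₁ + q * P₂)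
         (trans (/1-*-/ (suc (suc (x ℕ.+ s))) (cong (λ k → y ℕ.+ r ℕ.+ suc k) (ℕP.+-suc x s))) (cong (λ k → + k / 1) (numˡ x s)))
         (trans (/1-*-/ (suc (suc (y ℕ.+ r))) (den y r x s)) (cong (λ k → + k / 1) (numʳ y r))) ⟩
  + (suc s ℕ.+ suc x) / 1 * P₁ + + (suc r ℕ.+ suc y) / 1 * P₂ ∎
  where
  N eˡ eʳ P₁ P₂ : ℚ
  N = + suc (y ℕ.+ r ℕ.+ suc (x ℕ.+ suc s)) / 1
  eˡ = exitLeft (y ℕ.+ r) (suc (x ℕ.+ s))
  eʳ = exitRight (suc (y ℕ.+ r)) (x ℕ.+ s)
  P₁ = Prob (conf r (suc s) (suc x) (suc y))
  P₂ = Prob (conf (suc r) s (suc x) (suc y))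
  numˡ : ∀ x s → suc (suc (x ℕ.+ s)) ≡ suc s ℕ.+ suc x
  numˡ = ℕ-Solver.solve-∀
  numʳ : ∀ y r → suc (suc (y ℕ.+ r)) ≡ suc r ℕ.+ suc y
  numʳ = ℕ-Solver.solve-∀
  den : ∀ y r x s → y ℕ.+ r ℕ.+ suc (x ℕ.+ suc s) ≡ suc (y ℕ.+ r) ℕ.+ suc (x ℕ.+ s)
  den = ℕ-Solver.solve-∀

lemma4p1 : (x y r s : ℕ) → 1 ≤ x → 1 ≤ y → 1 ≤ r → 1 ≤ s →
    A r s x y ≡ ((+ (s Data.Nat.+ x)) / 1) * A (r ∸ 1) s x y
              + ((+ (r Data.Nat.+ y)) / 1) * A r (s ∸ 1) x y
lemma4p1 (suc x) (suc y) (suc r) (suc s) _ _ _ _ = begin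
  A (suc r) (suc s) (suc x) (suc y)
    ≡⟨ A-length (suc r) (suc s) (trans (length-conf (suc r) (suc s) x y) (cong (ℕ._+ suc (x ℕ.+ suc s)) (ℕP.+-suc y r))) ⟩
  + (suc n !) / 1 * P * I                        ≡⟨ cong (λ q → q * P * I) (/1-* (suc n) (n !)) ⟩
  + suc n / 1 * F * P * I
    ≡⟨ solve 4 (λ N F P I → N :* F :* P :* I := F :* (N :* P) :* I) refl (+ suc n / 1) F P I ⟩
  F * (+ suc n / 1 * P) * I                      ≡⟨ cong (λ p → F * p * I) (size*Prob-recurrence r s x y) ⟩
  F * (cˡ * P₁ + cʳ * P₂) * I
    ≡⟨ solve 6 (λ F cˡ cʳ P₁ P₂ I → F :* (cˡ :* P₁ :+ cʳ :* P₂) :* I := cˡ :* (F :* P₁ :* I) :+ cʳ :* (F :* P₂ :* I))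
         refl F cˡ cʳ P₁ P₂ I ⟩
  cˡ * (F * P₁ * I) + cʳ * (F * P₂ * I)
    ≡⟨ cong₂ (λ p q → cˡ * p + cʳ * q)
         (A-length r (suc s) (length-conf r (suc s) x y)) (A-length (suc r) s (trans (length-conf (suc r) s x y) (size y r x s))) ⟨
  cˡ * A r (suc s) (suc x) (suc y) + cʳ * A (suc r) s (suc x) (suc y) ∎
  where
  n : ℕ
  n = y ℕ.+ r ℕ.+ suc (x ℕ.+ suc s)
  F P P₁ P₂ cˡ cʳ I : ℚ
  F = + (n !) / 1
  P = Prob (conf (suc r) (suc s) (suc x) (suc y))
  P₁ = Prob (conf r (suc s) (suc x) (suc y))
  P₂ = Prob (conf (suc r) s (suc x) (suc y))
  cˡ = + (suc s ℕ.+ suc x) / 1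
  cʳ = + (suc r ℕ.+ suc y) / 1
  I = ((+ 1) / ((suc x ℕ.+ suc y ∸ 1) !)) {{(suc x ℕ.+ suc y ∸ 1) ℕP.!≢0}}
  A-length : ∀ r s {k} → length (conf r s (suc x) (suc y)) ≡ k →
    A r s (suc x) (suc y) ≡ + (k !) / 1 * Prob (conf r s (suc x) (suc y)) * I
  A-length r s refl = refl
  size : ∀ y r x s → y ℕ.+ suc r ℕ.+ suc (x ℕ.+ s) ≡ y ℕ.+ r ℕ.+ suc (x ℕ.+ suc s)
  size = ℕ-Solver.solve-∀
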